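{- Let $B>1$ and $d>1$ be integers, and let $p$ be a prime not dividing $B$ such that $d$ divides $\operatorname{ord}(B,p)$. Then $p\in M_d(B)$, and moreover $p^h\in M_d(B)$ for every integer $h>0$.
   Context: For integers $B>1$, $N>1$ with $\gcd(N,B)=1$, let $e=\operatorname{ord}(B,N)$ (least $e>0$ with $B^e\equiv1\pmod N$). For a divisor $d$ of $e$ put $k=e/d$. For $x$ with $1\le x<N$, $\gcd(x,N)=1$, let $x/N=0.a_1a_2\ldots$ be its base-$B$ expansion (purely periodic with period $a_1\ldots a_e$), and let $S_d(x)=\sum_{j=1}^d\sum_{i=1}^k a_{(j-1)k+i}B^{k-i}$ be the sum of the $d$ integers represented in base $B$ by the $d$ consecutive blocks of length $k$ of the period. We say $N\in M_d(B)$ (the base-$B$ Midy property for the divisor $d$) if $d\mid e$ and $S_d(x)\equiv0\pmod{B^k-1}$ for every such $x$. -}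

module Defs where

open import Data.Nat using (ℕ; zero; suc; _+_; _*_; _∸_; _^_; _≤_; _<_)
open import Data.Nat.DivMod using (_/_; _%_)
open import Data.Nat.Divisibility using (_∣_)
open import Data.Nat.Coprimality using (Coprime)
open import Data.Product using (Σ; ∃; _×_)
open import Relation.Binary.PropositionalEquality using (_≡_)

-- total division/remainder (the divisor-zero cases never arise below,
-- since N > 1 and B > 1 are required everywhere they are used)
divℕ : ℕ → ℕ → ℕ
divℕ m zero    = zero
divℕ m (suc n) = m / suc n

modℕ : ℕ → ℕ → ℕ
modℕ m zero    = m
modℕ m (suc n) = m % suc n

sum1 : ℕ → (ℕ → ℕ) → ℕ
sum1 zero    f = zero
sum1 (suc n) f = sum1 n f + f (suc n)

-- a_i (i ≥ 1): the i-th base-B digit after the point of x/N,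
-- i.e. ⌊x·B^i / N⌋ mod B
digit : (B N x i : ℕ) → ℕ
digit B N x i = modℕ (divℕ (x * B ^ i) N) B

IsOrd : (B N e : ℕ) → Set
IsOrd B N e =
  0 < e × N ∣ (B ^ e ∸ 1) × (∀ e′ → 0 < e′ → N ∣ (B ^ e′ ∸ 1) → e ≤ e′)

S : (B N d k x : ℕ) → ℕ
S B N d k x = sum1 d (λ j → sum1 k (λ i → digit B N x ((j ∸ 1) * k + i) * B ^ (k ∸ i)))

InM : (d B N : ℕ) → Set
InM d B N =
  1 < N × Coprime N B ×
  Σ ℕ (λ e → Σ ℕ (λ k →
    IsOrd B N e × e ≡ d * k ×
    (∀ x → 1 ≤ x → x < N → Coprime x N → (B ^ k ∸ 1) ∣ S B N d k x)))

{-# OPTIONS --safe #-}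
-- Let e = ord(B, N) = d k and w = B^k - 1, so that B^e - 1 = w R with R = 1 + B^k + ... + B^((d-1)k).
-- If p ∣ w then R ≡ d (mod p), and p ∤ d because d ∣ ord(B, p) < p; so for N = p^h the prime p
-- divides at most one of w and R. As k < e forces N ∤ w, we get N ∣ R. Midy's telescoping identity
-- S_d(x) + w Σ_{j<d} ⌊x B^(jk) / N⌋ = ⌊x B^e / N⌋ = x w R / N then shows w ∣ S_d(x).
module Submission where

open import Defs
open import Data.Nat
open import Data.Nat.Properties
open import Data.Nat.DivMod
open import Data.Nat.Divisibility
open import Data.Nat.Induction using (<-rec)
open import Data.Nat.Coprimality using (Coprime; coprime-divisor) renaming (sym to coprime-sym)
open import Data.Nat.Primality using (Prime; prime⇒irreducible; prime⇒nonTrivial)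
open import Data.Nat.Tactic.RingSolver using (solve-∀)
open import Data.Fin using (Fin; zero; toℕ; punchOut)
open import Data.Fin.Properties using (pigeonhole; punchOut-injective; toℕ-fromℕ<; toℕ<n)
open import Data.Product using (_×_; _,_; ∃-syntax)
open import Data.Sum using (inj₁; inj₂)
open import Relation.Nullary using (¬_; yes; no; contradiction)
open import Relation.Nullary.Decidable using (_×-dec_)
open import Relation.Unary using (Pred; Decidable)
open import Relation.Binary.PropositionalEquality
open import Function using (_∘_)
open import Algebra.Properties.CommutativeSemigroup *-commutativeSemigroup using (x∙yz≈y∙xz; x∙yz≈xz∙y)

coprime-* : ∀ {m n o} → Coprime m n → Coprime m o → Coprime m (n * o)
coprime-* {m} {n} m⊥n m⊥o {i} (i∣m , i∣n*o) = m⊥o (i∣m , coprime-divisor i⊥n i∣n*o)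
  where
  i⊥n : Coprime i n
  i⊥n (j∣i , j∣n) = m⊥n (∣-trans j∣i i∣m , j∣n)

coprime-^ : ∀ {m n} → Coprime m n → ∀ h → Coprime m (n ^ h)
coprime-^ _   zero    (_ , i∣1) = ∣1⇒≡1 i∣1
coprime-^ m⊥n (suc h) = coprime-* m⊥n (coprime-^ m⊥n h)

prime∤⇒coprime : ∀ {p m} → Prime p → ¬ p ∣ m → Coprime p m
prime∤⇒coprime p-prime p∤m (i∣p , i∣m) with prime⇒irreducible p-prime i∣p
... | inj₁ i≡1 = i≡1
... | inj₂ refl = contradiction i∣m p∤m

OnlyPrimeFactor : ℕ → ℕ → Set
OnlyPrimeFactor p N = ∀ {m} → ¬ p ∣ m → Coprime N m

^-onlyPrimeFactor : ∀ {p} → Prime p → ∀ h → OnlyPrimeFactor p (p ^ h)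
^-onlyPrimeFactor p-prime h p∤m = coprime-sym (coprime-^ (coprime-sym (prime∤⇒coprime p-prime p∤m)) h)

module _ {N : ℕ} where

  *-pres-∣∸1 : ∀ a b → N ∣ a ∸ 1 → N ∣ b ∸ 1 → N ∣ a * b ∸ 1
  *-pres-∣∸1 zero    b       _     _     = N ∣0
  *-pres-∣∸1 (suc a) zero    _     _     rewrite *-zeroʳ a = N ∣0
  *-pres-∣∸1 (suc a) (suc b) N∣a∸1 N∣b∸1 = ∣m∣n⇒∣m+n N∣b∸1 (∣m⇒∣m*n (suc b) N∣a∸1)

  ^-pres-∣∸1 : ∀ a h → N ∣ a ∸ 1 → N ∣ a ^ h ∸ 1
  ^-pres-∣∸1 a zero    _     = N ∣0
  ^-pres-∣∸1 a (suc h) N∣a∸1 = *-pres-∣∸1 a (a ^ h) N∣a∸1 (^-pres-∣∸1 a h N∣a∸1)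

  ∣∸1-cancelˡ : ∀ a b → 0 < a → N ∣ a * b ∸ 1 → N ∣ a ∸ 1 → N ∣ b ∸ 1
  ∣∸1-cancelˡ (suc a) zero    _ _         _     = N ∣0
  ∣∸1-cancelˡ (suc a) (suc b) _ N∣ab∸1 N∣a∸1 =
    ∣m+n∣m⇒∣n (subst (N ∣_) (+-comm b (a * suc b)) N∣ab∸1) (∣m⇒∣m*n (suc b) N∣a∸1)

%-≡⇒∣∸ : ∀ a b N .{{_ : NonZero N}} → a % N ≡ b % N → N ∣ a ∸ b
%-≡⇒∣∸ a b N a%N≡b%N = divides (a / N ∸ b / N) (begin
    a ∸ b                                     ≡⟨ cong₂ _∸_ (m≡m%n+[m/n]*n a N) (m≡m%n+[m/n]*n b N) ⟩
    (a % N + a / N * N) ∸ (b % N + b / N * N) ≡⟨ cong (λ r → (r + a / N * N) ∸ (b % N + b / N * N)) a%N≡b%N ⟩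
    (b % N + a / N * N) ∸ (b % N + b / N * N) ≡⟨ [m+n]∸[m+o]≡n∸o (b % N) _ _ ⟩
    a / N * N ∸ b / N * N                     ≡⟨ *-distribʳ-∸ N (a / N) (b / N) ⟨
    (a / N ∸ b / N) * N                       ∎)
  where open ≡-Reasoning

module _ {ℓ} {P : Pred ℕ ℓ} (P? : Decidable P) where

  IsLeast : ℕ → Set ℓ
  IsLeast m = P m × (∀ {m′} → P m′ → m ≤ m′)

  least : ∀ n → P n → ∃[ m ] IsLeast m × m ≤ n
  least = <-rec (λ n → P n → ∃[ m ] IsLeast m × m ≤ n) step
    where
    step : ∀ n → (∀ {m} → m < n → P m → ∃[ l ] IsLeast l × l ≤ m) → P n → ∃[ m ] IsLeast m × m ≤ n
    step n below Pn with anyUpTo? P? n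
    ... | yes (m , m<n , Pm) = let l , least-l , l≤m = below m<n Pm in l , least-l , ≤-trans l≤m (<⇒≤ m<n)
    ... | no ∄m<n = n , (Pn , λ Pm′ → ≮⇒≥ λ m′<n → ∄m<n (_ , m′<n , Pm′)) , ≤-refl

module _ {B N : ℕ} where

  ord∣ : ∀ {e} .{{_ : NonZero B}} → IsOrd B N e → ∀ a → N ∣ B ^ a ∸ 1 → e ∣ a
  ord∣ {e} (0<e , N∣Bᵉ∸1 , minimal) a N∣Bᵃ∸1 = m%n≡0⇒n∣m a e (below-ord⇒0 (m%n<n a e) N∣B^[a%e]∸1)
    where
    instance
      e≢0 : NonZero e
      e≢0 = >-nonZero 0<e

    below-ord⇒0 : ∀ {r} → r < e → N ∣ B ^ r ∸ 1 → r ≡ 0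
    below-ord⇒0 {zero}  _   _ = refl
    below-ord⇒0 {suc r} r<e N∣Bʳ∸1 = contradiction (minimal (suc r) z<s N∣Bʳ∸1) (<⇒≱ r<e)

    B^a≡ : B ^ a ≡ B ^ (e * (a / e)) * B ^ (a % e)
    B^a≡ = begin
      B ^ a                       ≡⟨ cong (B ^_) (m≡m%n+[m/n]*n a e) ⟩
      B ^ (a % e + a / e * e)     ≡⟨ cong (B ^_) (trans (+-comm (a % e) _) (cong (_+ a % e) (*-comm (a / e) e))) ⟩
      B ^ (e * (a / e) + a % e)   ≡⟨ ^-distribˡ-+-* B (e * (a / e)) (a % e) ⟩
      B ^ (e * (a / e)) * B ^ (a % e) ∎
      where open ≡-Reasoning

    N∣B^[a%e]∸1 : N ∣ B ^ (a % e) ∸ 1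
    N∣B^[a%e]∸1 = ∣∸1-cancelˡ (B ^ (e * (a / e))) (B ^ (a % e)) (m^n>0 B (e * (a / e)))
      (subst (λ z → N ∣ z ∸ 1) B^a≡ N∣Bᵃ∸1)
      (subst (λ z → N ∣ z ∸ 1) (^-*-assoc B e (a / e)) (^-pres-∣∸1 (B ^ e) (a / e) N∣Bᵉ∸1))

  equal-residues⇒∣^∸1 : .{{_ : NonZero N}} → Coprime N B → ∀ {i j} → i ≤ j →
                        B ^ i % N ≡ B ^ j % N → N ∣ B ^ (j ∸ i) ∸ 1
  equal-residues⇒∣^∸1 N⊥B {i} {j} i≤j Bⁱ≡Bʲ =
    coprime-divisor (coprime-^ N⊥B i) (subst (N ∣_) Bʲ∸Bⁱ≡ N∣Bʲ∸Bⁱ)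
    where
    N∣Bʲ∸Bⁱ : N ∣ B ^ j ∸ B ^ i
    N∣Bʲ∸Bⁱ = %-≡⇒∣∸ (B ^ j) (B ^ i) N (sym Bⁱ≡Bʲ)
    Bʲ∸Bⁱ≡ : B ^ j ∸ B ^ i ≡ B ^ i * (B ^ (j ∸ i) ∸ 1)
    Bʲ∸Bⁱ≡ = begin
      B ^ j ∸ B ^ i                     ≡⟨ cong (λ z → B ^ z ∸ B ^ i) (m+[n∸m]≡n i≤j) ⟨
      B ^ (i + (j ∸ i)) ∸ B ^ i         ≡⟨ cong₂ _∸_ (^-distribˡ-+-* B i (j ∸ i)) (sym (*-identityʳ (B ^ i))) ⟩
      B ^ i * B ^ (j ∸ i) ∸ B ^ i * 1   ≡⟨ *-distribˡ-∸ (B ^ i) (B ^ (j ∸ i)) 1 ⟨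
      B ^ i * (B ^ (j ∸ i) ∸ 1)         ∎
      where open ≡-Reasoning

ord-exists : ∀ {B N} .{{_ : NonZero B}} → 1 < N → Coprime N B → ∃[ e ] IsOrd B N e × e < N
ord-exists {N = 1} (s≤s ())
ord-exists {B} {N@(suc (suc n))} 1<N N⊥B =
  let E , PE , E<N = period
      e , ((0<e , N∣Bᵉ∸1) , minimal) , e≤E = least P? E PE
  in e , (0<e , N∣Bᵉ∸1 , λ _ 0<e′ N∣Bᵉ′∸1 → minimal (0<e′ , N∣Bᵉ′∸1)) , ≤-<-trans e≤E E<N
  where
  P : Pred ℕ _
  P e = 0 < e × N ∣ B ^ e ∸ 1

  P? : Decidable P
  P? e = (0 <? e) ×-dec (N ∣? B ^ e ∸ 1)

  residue : Fin N → Fin N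
  residue i = B ^ toℕ i mod N

  toℕ-residue : ∀ i → toℕ (residue i) ≡ B ^ toℕ i % N
  toℕ-residue i = toℕ-fromℕ< (m%n<n (B ^ toℕ i) N)

  0≢residue : ∀ i → zero ≢ residue i
  0≢residue i 0≡rᵢ = <⇒≢ 1<N (sym (coprime-^ N⊥B (toℕ i) (∣-refl , N∣Bⁱ)))
    where
    N∣Bⁱ : N ∣ B ^ toℕ i
    N∣Bⁱ = m%n≡0⇒n∣m (B ^ toℕ i) N (trans (sym (toℕ-residue i)) (cong toℕ (sym 0≡rᵢ)))

  -- pigeonhole: N powers of B, but only N - 1 nonzero residues
  period : ∃[ E ] P E × E < N
  period =
    let i , j , i<j , rᵢ≡rⱼ = pigeonhole (n<1+n (suc n)) (λ i → punchOut (0≢residue i))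
        Bⁱ≡Bʲ = trans (sym (toℕ-residue i))
                  (trans (cong toℕ (punchOut-injective (0≢residue i) (0≢residue j) rᵢ≡rⱼ)) (toℕ-residue j))
    in toℕ j ∸ toℕ i , (m<n⇒0<n∸m i<j , equal-residues⇒∣^∸1 N⊥B (<⇒≤ i<j) Bⁱ≡Bʲ) ,
       ≤-<-trans (m∸n≤m (toℕ j) (toℕ i)) (toℕ<n j)

repunit : ℕ → ℕ → ℕ
repunit u zero    = 0
repunit u (suc d) = suc (u * repunit u d)

[1+w]^d≡1+w*repunit : ∀ w d → suc w ^ d ≡ suc (w * repunit (suc w) d)
[1+w]^d≡1+w*repunit w zero    = cong suc (sym (*-zeroʳ w))
[1+w]^d≡1+w*repunit w (suc d) = begin
  suc w * suc w ^ d                      ≡⟨ cong (suc w *_) ([1+w]^d≡1+w*repunit w d) ⟩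
  suc w * suc (w * R)                    ≡⟨ regroup w R ⟩
  suc (w * suc (suc w * R))              ∎
  where
  open ≡-Reasoning
  R = repunit (suc w) d
  regroup : ∀ w R → suc w * suc (w * R) ≡ suc (w * suc (suc w * R))
  regroup = solve-∀

^-*≡1+w*repunit : ∀ B k d {w} → B ^ k ≡ suc w → B ^ (d * k) ≡ suc (w * repunit (suc w) d)
^-*≡1+w*repunit B k d {w} Bᵏ≡1+w = begin
  B ^ (d * k)   ≡⟨ cong (B ^_) (*-comm d k) ⟩
  B ^ (k * d)   ≡⟨ ^-*-assoc B k d ⟨
  (B ^ k) ^ d   ≡⟨ cong (_^ d) Bᵏ≡1+w ⟩
  suc w ^ d     ≡⟨ [1+w]^d≡1+w*repunit w d ⟩
  suc (w * repunit (suc w) d) ∎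
  where open ≡-Reasoning

-- repunit (1 + w) d ≡ d (mod p); the offset m is what makes the induction go through
∣repunit+m⇒∣d+m : ∀ {p w} d m → p ∣ w → p ∣ repunit (suc w) d + m → p ∣ d + m
∣repunit+m⇒∣d+m         zero    m _   p∣m   = p∣m
∣repunit+m⇒∣d+m {p} {w} (suc d) m p∣w p∣R′+m =
  subst (p ∣_) (+-suc d m) (∣repunit+m⇒∣d+m d (suc m) p∣w p∣R+1+m)
  where
  R = repunit (suc w) d
  regroup : ∀ w R m → suc (suc w * R) + m ≡ w * R + (R + suc m)
  regroup = solve-∀
  p∣R+1+m : p ∣ R + suc m
  p∣R+1+m = ∣m+n∣m⇒∣n (subst (p ∣_) (regroup w R m) p∣R′+m) (∣m⇒∣m*n R p∣w)

∣w*repunit⇒∣repunit : ∀ {p N w d} → ¬ p ∣ d → OnlyPrimeFactor p N →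
  N ∣ w * repunit (suc w) d → ¬ N ∣ w → N ∣ repunit (suc w) d
∣w*repunit⇒∣repunit {p} {N} {w} {d} p∤d N-primary N∣wR N∤w with p ∣? w
... | no  p∤w = coprime-divisor (N-primary p∤w) N∣wR
... | yes p∣w = contradiction (coprime-divisor (N-primary p∤R) (subst (N ∣_) (*-comm w R) N∣wR)) N∤w
  where
  R = repunit (suc w) d
  p∤R : ¬ p ∣ R
  p∤R p∣R = p∤d (subst (p ∣_) (+-identityʳ d)
                  (∣repunit+m⇒∣d+m d 0 p∣w (subst (p ∣_) (sym (+-identityʳ R)) p∣R)))

sum1-cong : ∀ n {f g : ℕ → ℕ} → (∀ {i} → i ≤ n → f i ≡ g i) → sum1 n f ≡ sum1 n g
sum1-cong zero    f≗g = refl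
sum1-cong (suc n) f≗g = cong₂ _+_ (sum1-cong n (f≗g ∘ m≤n⇒m≤1+n)) (f≗g ≤-refl)

sum1-*ˡ : ∀ n c (f : ℕ → ℕ) → sum1 n (λ i → c * f i) ≡ c * sum1 n f
sum1-*ˡ zero    c f = sym (*-zeroʳ c)
sum1-*ˡ (suc n) c f = trans (cong (_+ c * f (suc n)) (sum1-*ˡ n c f)) (sym (*-distribˡ-+ c (sum1 n f) (f (suc n))))

module Expansion (b n x : ℕ) where

  B = suc b
  N = suc n

  quot : ℕ → ℕ
  quot i = x * B ^ i / N

  a : ℕ → ℕ
  a = digit B N x

  block : ℕ → ℕ → ℕ
  block m k = sum1 k (λ i → a (m + i) * B ^ (k ∸ i))

  quot-suc : ∀ i → quot (suc i) ≡ B * quot i + a (suc i)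
  quot-suc i = begin
    Q                   ≡⟨ m≡m%n+[m/n]*n Q B ⟩
    Q % B + Q / B * B   ≡⟨ cong (λ z → Q % B + z * B) Q/B≡quotᵢ ⟩
    Q % B + quot i * B  ≡⟨ +-comm (Q % B) (quot i * B) ⟩
    quot i * B + Q % B  ≡⟨ cong (_+ Q % B) (*-comm (quot i) B) ⟩
    B * quot i + a (suc i) ∎
    where
    open ≡-Reasoning
    Q = quot (suc i)
    Q/B≡quotᵢ : Q / B ≡ quot i
    Q/B≡quotᵢ = begin
      x * (B * B ^ i) / N / B   ≡⟨ m/n/o≡m/[n*o] (x * (B * B ^ i)) N B ⟩
      x * (B * B ^ i) / (N * B) ≡⟨ cong (_/ (N * B)) (x∙yz≈xz∙y x B (B ^ i)) ⟩
      x * B ^ i * B / (N * B)   ≡⟨ m*n/o*n≡m/o (x * B ^ i) B N ⟩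
      quot i                    ∎

  block-suc : ∀ m k → block m (suc k) ≡ B * block m k + a (m + suc k)
  block-suc m k = cong₂ _+_ (trans (sum1-cong k shift) (sum1-*ˡ k B _)) last
    where
    shift : ∀ {i} → i ≤ k → a (m + i) * B ^ (suc k ∸ i) ≡ B * (a (m + i) * B ^ (k ∸ i))
    shift {i} i≤k = begin
      a (m + i) * B ^ (suc k ∸ i)     ≡⟨ cong (λ z → a (m + i) * B ^ z) (+-∸-assoc 1 i≤k) ⟩
      a (m + i) * (B * B ^ (k ∸ i))   ≡⟨ x∙yz≈y∙xz (a (m + i)) B (B ^ (k ∸ i)) ⟩
      B * (a (m + i) * B ^ (k ∸ i))   ∎
      where open ≡-Reasoning
    last : a (m + suc k) * B ^ (k ∸ k) ≡ a (m + suc k)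
    last = trans (cong (λ z → a (m + suc k) * B ^ z) (n∸n≡0 k)) (*-identityʳ _)

  quot-+ : ∀ m k → quot (m + k) ≡ B ^ k * quot m + block m k
  quot-+ m zero    = trans (cong quot (+-identityʳ m)) (sym (trans (+-identityʳ _) (+-identityʳ _)))
  quot-+ m (suc k) = begin
    quot (m + suc k)                                ≡⟨ cong quot (+-suc m k) ⟩
    quot (suc (m + k))                              ≡⟨ quot-suc (m + k) ⟩
    B * quot (m + k) + a (suc (m + k))              ≡⟨ cong₂ (λ q i → B * q + a i) (quot-+ m k) (sym (+-suc m k)) ⟩
    B * (B ^ k * quot m + block m k) + a (m + suc k) ≡⟨ regroup B (B ^ k) (quot m) (block m k) (a (m + suc k)) ⟩
    B * B ^ k * quot m + (B * block m k + a (m + suc k)) ≡⟨ cong (B ^ suc k * quot m +_) (block-suc m k) ⟨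
    B ^ suc k * quot m + block m (suc k)            ∎
    where
    open ≡-Reasoning
    regroup : ∀ B P q s c → B * (P * q + s) + c ≡ B * P * q + (B * s + c)
    regroup = solve-∀

  quot-of-≡1 : ∀ {e c} → x < N → B ^ e ≡ suc (c * N) → quot e ≡ x * c
  quot-of-≡1 {e} {c} x<N Bᵉ≡1+cN = begin
    x * B ^ e / N           ≡⟨ cong (λ z → x * z / N) Bᵉ≡1+cN ⟩
    x * suc (c * N) / N     ≡⟨ cong (_/ N) (trans (*-suc x (c * N)) (cong (x +_) (sym (*-assoc x c N)))) ⟩
    (x + x * c * N) / N     ≡⟨ +-distrib-/-∣ʳ x (n∣m*n (x * c)) ⟩
    x / N + x * c * N / N   ≡⟨ cong₂ _+_ (m<n⇒m/n≡0 x<N) (m*n/n≡m (x * c) N) ⟩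
    x * c                   ∎
    where open ≡-Reasoning

  module _ (k : ℕ) {w : ℕ} (Bᵏ≡1+w : B ^ k ≡ suc w) (x<N : x < N) where

    quot-sum : ℕ → ℕ
    quot-sum d = sum1 d (λ j → quot ((j ∸ 1) * k))

    -- the j-th block equals quot (j k) ∸ B^k quot ((j - 1) k), so the block sum telescopes
    w*quot-sum+S≡quot : ∀ d → w * quot-sum d + S B N d k x ≡ quot (d * k)
    w*quot-sum+S≡quot zero    =
      trans (+-identityʳ (w * 0)) (trans (*-zeroʳ w) (sym (m<n⇒m/n≡0 (subst (_< N) (sym (*-identityʳ x)) x<N))))
    w*quot-sum+S≡quot (suc d) = begin
      w * (L + quot (d * k)) + (Sd + blk)           ≡⟨ cong (λ q → w * (L + q) + (Sd + blk)) (w*quot-sum+S≡quot d) ⟨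
      w * (L + (w * L + Sd)) + (Sd + blk)           ≡⟨ regroup w L Sd blk ⟩
      suc w * (w * L + Sd) + blk                    ≡⟨ cong₂ (λ u q → u * q + blk) (sym Bᵏ≡1+w) (w*quot-sum+S≡quot d) ⟩
      B ^ k * quot (d * k) + blk                    ≡⟨ quot-+ (d * k) k ⟨
      quot (d * k + k)                              ≡⟨ cong quot (+-comm (d * k) k) ⟩
      quot (suc d * k)                              ∎
      where
      open ≡-Reasoning
      L = quot-sum d
      Sd = S B N d k x
      blk = block (d * k) k
      regroup : ∀ w L s b → w * (L + (w * L + s)) + (s + b) ≡ suc w * (w * L + s) + b
      regroup = solve-∀

midy : ∀ {b n x} k d {w} → suc b ^ k ≡ suc w → x < suc n → suc n ∣ repunit (suc w) d →
       w ∣ S (suc b) (suc n) d k x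
midy {b} {n} {x} k d {w} Bᵏ≡1+w x<N (divides t R≡t*N) =
  ∣m+n∣m⇒∣n (subst (w ∣_) (sym (w*quot-sum+S≡quot k Bᵏ≡1+w x<N d)) w∣quot)
            (m∣m*n (quot-sum k Bᵏ≡1+w x<N d))
  where
  open Expansion b n x
  Bᵈᵏ≡1+wtN : B ^ (d * k) ≡ suc (w * t * N)
  Bᵈᵏ≡1+wtN = trans (^-*≡1+w*repunit B k d Bᵏ≡1+w) (cong suc (trans (cong (w *_) R≡t*N) (sym (*-assoc w t N))))
  w∣quot : w ∣ quot (d * k)
  w∣quot = subst (w ∣_) (sym (quot-of-≡1 {e = d * k} x<N Bᵈᵏ≡1+wtN)) (∣n⇒∣m*n x (m∣m*n t))

ord≡d*k⇒∤B^k∸1 : ∀ {B N d k} → 1 < d → IsOrd B N (d * k) → ¬ N ∣ B ^ k ∸ 1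
ord≡d*k⇒∤B^k∸1 {d = d} {k} 1<d (0<dk , _ , minimal) N∣Bᵏ∸1 =
  <⇒≱ k<dk (minimal k (>-nonZero⁻¹ k) N∣Bᵏ∸1)
  where
  instance
    k≢0 : NonZero k
    k≢0 = m*n≢0⇒n≢0 d {{>-nonZero 0<dk}}
  k<dk : k < d * k
  k<dk = subst (k <_) (*-comm k d) (m<m*n k d 1<d)

^≡1+[^∸1] : ∀ B .{{_ : NonZero B}} k → B ^ k ≡ suc (B ^ k ∸ 1)
^≡1+[^∸1] B k = sym (suc-pred (B ^ k) {{m^n≢0 B k}})

ord-∣-repunit : ∀ {B p N d k} .{{_ : NonZero B}} → 1 < d → ¬ p ∣ d → OnlyPrimeFactor p N →
                IsOrd B N (d * k) → N ∣ repunit (suc (B ^ k ∸ 1)) d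
ord-∣-repunit {B} {N = N} {d} {k} 1<d p∤d N-primary ordN@(_ , N∣Bᵈᵏ∸1 , _) =
  ∣w*repunit⇒∣repunit p∤d N-primary N∣wR (ord≡d*k⇒∤B^k∸1 1<d ordN)
  where
  N∣wR : N ∣ (B ^ k ∸ 1) * repunit (suc (B ^ k ∸ 1)) d
  N∣wR = subst (λ z → N ∣ z ∸ 1) (^-*≡1+w*repunit B k d (^≡1+[^∸1] B k)) N∣Bᵈᵏ∸1

prime⇒1< : ∀ {p} → Prime p → 1 < p
prime⇒1< {p} p-prime = nonTrivial⇒n>1 p {{prime⇒nonTrivial p-prime}}

primePower-InM : ∀ {b d p N} → 1 < d → Prime p → ¬ p ∣ suc b → (∀ e → IsOrd (suc b) p e → d ∣ e) →
                 1 < N → p ∣ N → OnlyPrimeFactor p N → InM d (suc b) N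
primePower-InM {b} {d} {p} {N@(suc _)} 1<d p-prime p∤B d∣ordₚ 1<N p∣N N-primary
  with ord-exists (prime⇒1< p-prime) (prime∤⇒coprime p-prime p∤B) | ord-exists 1<N (N-primary p∤B)
... | eₚ , ordₚ@(0<eₚ , _) , eₚ<p | e , ordN@(_ , N∣Bᵉ∸1 , _) , _ =
  1<N , N-primary p∤B , e , k , ordN , e≡d*k ,
  λ x _ x<N _ → midy k d (^≡1+[^∸1] (suc b) k) x<N N∣R
  where
  d∣e : d ∣ e
  d∣e = ∣-trans (d∣ordₚ eₚ ordₚ) (ord∣ ordₚ e (∣-trans p∣N N∣Bᵉ∸1))
  k = quotient d∣e
  e≡d*k : e ≡ d * k
  e≡d*k = m∣n⇒n≡m*quotient d∣e
  p∤d : ¬ p ∣ d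
  p∤d p∣d = <⇒≱ eₚ<p (≤-trans (∣⇒≤ {{>-nonZero (<-trans z<s 1<d)}} p∣d)
                               (∣⇒≤ {{>-nonZero 0<eₚ}} (d∣ordₚ eₚ ordₚ)))
  N∣R : N ∣ repunit (suc (suc b ^ k ∸ 1)) d
  N∣R = ord-∣-repunit 1<d p∤d N-primary (subst (IsOrd (suc b) N) e≡d*k ordN)

theorem3 : (B d p : ℕ) → 1 < B → 1 < d → Prime p → ¬ (p ∣ B) →
    (∀ e → IsOrd B p e → d ∣ e) →
    InM d B p × (∀ h → 0 < h → InM d B (p ^ h))
theorem3 zero    d p () _ _ _ _
theorem3 (suc b) d p _ 1<d p-prime p∤B d∣ordₚ =
    primePower-InM 1<d p-prime p∤B d∣ordₚ 1<p ∣-refl (prime∤⇒coprime p-prime)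
  , λ { (suc h) _ → primePower-InM 1<d p-prime p∤B d∣ordₚ (^-monoʳ-< p 1<p {0} {suc h} z<s) (m∣m*n (p ^ h))
                      (^-onlyPrimeFactor p-prime (suc h)) }
  where
  1<p : 1 < p
  1<p = prime⇒1< p-prime
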